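{- Let $T$ be a pre-Galois word, $p_o=\mathrm{Per}_o(T)$ and $p_e=\mathrm{Per}_e(T)$. Let $z$ be a symbol and $T'=T\cdot z$ with $T'[1..|T|-p_o+1]\succ_{\mathrm{alt}}T'[p_o+1..|T|+1]$. Let $\mathrm{SPref}(T')=T'[1..p]$. If $p=p_o$ and $|T|\ge 3p$, then $\mathrm{SPref}(T'[p+1..|T'|])=T'[p+1..3p]=T'[1..2p]$.
   Context: $W[i..j]$ is the factor from position $i$ to $j$ (1-indexed), and is $\varepsilon$ if $i>j$. An integer $p\in[1..|W|]$ is a period of $W$ if $W[i+p]=W[i]$ for all $i\in[1..|W|-p]$. $\mathrm{Per}_o(W)$ (resp. $\mathrm{Per}_e(W)$) is the shortest odd (resp. even) period of $W$, set to $|W|+1$ if none exists. Alternating order: for words $S,T$ with $S^\omega\neq T^\omega$ ($X^\omega$ the infinite repetition of $X$), let $j$ be the first position with $S^\omega[j]\neq T^\omega[j]$; $S\prec_{\mathrm{alt}}T$ if $j$ is odd and $S^\omega[j]<T^\omega[j]$, or $j$ is even and $S^\omega[j]>T^\omega[j]$. $S=_{\mathrm{alt}}T$ if $S^\omega=T^\omega$; $\varepsilon\succ_{\mathrm{alt}}X$ for every nonempty $X$; $\preceq_{\mathrm{alt}}$ means $\prec_{\mathrm{alt}}$ or $=_{\mathrm{alt}}$, and $\succeq_{\mathrm{alt}}$ is its reverse. A word $T$ is pre-Galois if every proper suffix $S$ of $T$ is a prefix of $T$ or satisfies $S\succ_{\mathrm{alt}}T$. For a nonempty word $W$, $\mathrm{SPref}(W)$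 is the shortest nonempty prefix $P$ of $W$ such that $P\succeq_{\mathrm{alt}}W$ if $|P|$ is even and $P\preceq_{\mathrm{alt}}W$ if $|P|$ is odd. -}

module Defs where

open import Data.Nat using (ℕ; zero; suc; _+_; _*_; _∸_; _≤_; _<_; _>_)
open import Data.Nat.DivMod using (_%_)
open import Data.List using (List; []; _∷_; length; take; drop)
open import Data.Product using (Σ; _×_; _,_; ∃)
open import Data.Sum using (_⊎_)
open import Relation.Binary.PropositionalEquality using (_≡_; _≢_)
open import Relation.Nullary using (¬_)

Word : Set
Word = List ℕ

-- 0-indexed access (default 0 outside the word; only used in range).
nth : Word → ℕ → ℕ
nth []       _       = 0
nth (x ∷ _)  zero    = x
nth (_ ∷ xs) (suc i) = nth xs i

-- X^ω at 0-based position i (X nonempty; value for ε is irrelevant).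
omega : Word → ℕ → ℕ
omega []       _ = 0
omega (x ∷ xs) i = nth (x ∷ xs) (i % suc (length xs))

-- W[i..j], 1-indexed, ε if i > j.
factor : Word → ℕ → ℕ → Word
factor W i j = take (suc j ∸ i) (drop (i ∸ 1) W)

IsEven : ℕ → Set
IsEven n = n % 2 ≡ 0

IsOdd : ℕ → Set
IsOdd n = n % 2 ≡ 1

-- Alternating order.  A 0-based index j corresponds to the 1-based
-- position j+1, so "position odd" is "index even".
_≺alt_ : Word → Word → Set
S ≺alt T =
  (S ≢ [] × T ≡ [])
  ⊎ (S ≢ [] × T ≢ [] ×
     ∃ λ j → (∀ i → i < j → omega S i ≡ omega T i) ×
             ((IsEven j × omega S j < omega T j) ⊎ (IsOdd j × omega S j > omega T j)))

_=alt_ : Word → Word → Set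
S =alt T = (S ≡ [] × T ≡ []) ⊎ (S ≢ [] × T ≢ [] × (∀ i → omega S i ≡ omega T i))

_⪯alt_ : Word → Word → Set
S ⪯alt T = (S ≺alt T) ⊎ (S =alt T)

IsPeriod : Word → ℕ → Set
IsPeriod W p = 1 ≤ p × p ≤ length W × (∀ i → i + p < length W → nth W (i + p) ≡ nth W i)

IsPerO : Word → ℕ → Set
IsPerO W q =
  (IsOdd q × IsPeriod W q × (∀ r → r < q → IsOdd r → ¬ IsPeriod W r))
  ⊎ ((∀ r → IsOdd r → ¬ IsPeriod W r) × q ≡ suc (length W))

IsPerE : Word → ℕ → Set
IsPerE W q =
  (IsEven q × IsPeriod W q × (∀ r → r < q → IsEven r → ¬ IsPeriod W r))
  ⊎ ((∀ r → IsEven r → ¬ IsPeriod W r) × q ≡ suc (length W))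

IsPrefix : Word → Word → Set
IsPrefix P T = ∃ λ R → T ≡ P Data.List.++ R

PreGalois : Word → Set
PreGalois T = ∀ k → 1 ≤ k → k ≤ length T →
  IsPrefix (drop k T) T ⊎ (T ≺alt drop k T)

SPrefCond : Word → Word → Set
SPrefCond W P = (IsEven (length P) × W ⪯alt P) ⊎ (IsOdd (length P) × P ⪯alt W)

IsSPref : Word → Word → Set
IsSPref W P =
  1 ≤ length P × length P ≤ length W × P ≡ take (length P) W × SPrefCond W P ×
  (∀ k → 1 ≤ k → k < length P → ¬ SPrefCond W (take k W))

-- Let Q = (T[1..p])^ω with p = Per_o(T). As 2p ≤ |T|, p is the least period of T (for a shorter even
-- period s, p - s would be a shorter odd one), so pre-Galois makes Q strictly alt-smaller than each
-- rotation Q[s+1..], 0 < s < p. For 0 < k < 2p, k ≠ p, the power (Q[1..k])^ω first leaves Q at k + e,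
-- where e is where Q first leaves its rotation by k: below Q for even k, above it for odd k, and for
-- even k the position k + e stays below 2p. The hypothesis on T' says that V = T'[p+1..|T'|] follows Q
-- up to |T| - p ≥ 2p and then falls below it. Hence V ≺ (V[1..2p])^ω = Q, so V[1..2p] = T'[1..2p]
-- qualifies as SPref(V), whereas every shorter prefix fails on the side its parity requires.
module Submission where

open import Defs
open import Algebra.Properties.CommutativeSemigroup using (x∙yz≈y∙xz)
open import Data.Bool using (Bool; true; false; not; _xor_; if_then_else_)
open import Data.Bool.Properties using (not-involutive; not-distribˡ-xor; not-injective)
open import Data.Nat using (ℕ; zero; suc; _+_; _*_; _∸_; _≤_; _<_; z≤n; s≤s; z<s; _<?_; _≟_)
open import Data.Nat.Properties
open import Data.Nat.DivMod using (_%_; m<n⇒m%n≡m; [m+n]%n≡m%n)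
open import Data.List using ([]; _∷_; length; take; drop; _++_; [_])
open import Data.List.Properties using (length-take; length-drop; length-++; take-all)
open import Data.Product using (_×_; _,_; proj₁; proj₂; ∃-syntax)
open import Data.Sum using (inj₁; inj₂; [_,_]′)
open import Function using (_∘_)
open import Relation.Binary.Definitions using (tri<; tri≈; tri>)
open import Relation.Binary.PropositionalEquality hiding ([_])
open import Relation.Nullary using (¬_; Dec; yes; no; contradiction)

open ≡-Reasoning

odd? : ℕ → Bool
odd? zero    = false
odd? (suc n) = not (odd? n)

odd?-+ : ∀ m n → odd? (m + n) ≡ odd? m xor odd? n
odd?-+ zero    n = refl
odd?-+ (suc m) n = trans (cong not (odd?-+ m n)) (not-distribˡ-xor (odd? m) (odd? n))

%2≡odd? : ∀ n → n % 2 ≡ (if odd? n then 1 else 0)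
%2≡odd? zero          = refl
%2≡odd? (suc zero)    = refl
%2≡odd? (suc (suc n)) rewrite not-involutive (odd? n) = %2≡odd? n

IsOdd⇒odd? : ∀ n → IsOdd n → odd? n ≡ true
IsOdd⇒odd? n n-odd with odd? n | %2≡odd? n
... | true  | _     = refl
... | false | n%2≡0 = contradiction (trans (sym n-odd) n%2≡0) 1+n≢0

IsEven⇒odd? : ∀ n → IsEven n → odd? n ≡ false
IsEven⇒odd? n n-even with odd? n | %2≡odd? n
... | false | _     = refl
... | true  | n%2≡1 = contradiction (trans (sym n-even) n%2≡1) 0≢1+n

odd?⇒IsOdd : ∀ n → odd? n ≡ true → IsOdd n
odd?⇒IsOdd n n-odd = trans (%2≡odd? n) (cong (λ b → if b then 1 else 0) n-odd)

odd?⇒IsEven : ∀ n → odd? n ≡ false → IsEven n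
odd?⇒IsEven n n-even = trans (%2≡odd? n) (cong (λ b → if b then 1 else 0) n-even)

odd?⇒1≤ : ∀ {n} → odd? n ≡ true → 1 ≤ n
odd?⇒1≤ {zero}  ()
odd?⇒1≤ {suc n} _ = s≤s z≤n

infix 4 _<⟨_⟩_ _≺[_]_

_<⟨_⟩_ : ℕ → Bool → ℕ → Set
x <⟨ false ⟩ y = x < y
x <⟨ true  ⟩ y = y < x

<⟨⟩⇒≢ : ∀ b {x y} → x <⟨ b ⟩ y → x ≢ y
<⟨⟩⇒≢ false x<y refl = n≮n _ x<y
<⟨⟩⇒≢ true  y<x refl = n≮n _ y<x

<⟨⟩-asym : ∀ b {x y} → x <⟨ b ⟩ y → ¬ y <⟨ b ⟩ x
<⟨⟩-asym false = <-asym
<⟨⟩-asym true  = <-asym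

<⟨⟩-trans : ∀ b {x y w} → x <⟨ b ⟩ y → y <⟨ b ⟩ w → x <⟨ b ⟩ w
<⟨⟩-trans false x<y y<w = <-trans x<y y<w
<⟨⟩-trans true  y<x w<y = <-trans w<y y<x

<⟨⟩-flip : ∀ b {x y} → x <⟨ b ⟩ y → y <⟨ not b ⟩ x
<⟨⟩-flip false x<y = x<y
<⟨⟩-flip true  y<x = y<x

Seq : Set
Seq = ℕ → ℕ

_≺[_]_ : Seq → ℕ → Seq → Set
A ≺[ d ] B = (∀ i → i < d → A i ≡ B i) × A d <⟨ odd? d ⟩ B d

≺⇒≢ : ∀ {A B d} → A ≺[ d ] B → A d ≢ B d
≺⇒≢ {d = d} (_ , A<B) = <⟨⟩⇒≢ (odd? d) A<B

≺-asym : ∀ {A B d d′} → A ≺[ d ] B → ¬ B ≺[ d′ ] A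
≺-asym {d = d} {d′} A≺B@(A≡B , A<B) B≺A@(B≡A , B<A) with <-cmp d d′
... | tri< d<d′ _ _ = ≺⇒≢ A≺B (sym (B≡A d d<d′))
... | tri≈ _ refl _ = <⟨⟩-asym (odd? d) A<B B<A
... | tri> _ _ d′<d = ≺⇒≢ B≺A (sym (A≡B d′ d′<d))

≺-trans : ∀ {A B C d d′} → A ≺[ d ] B → B ≺[ d′ ] C → ∃[ d″ ] A ≺[ d″ ] C
≺-trans {A} {B} {C} {d} {d′} (A≡B , A<B) (B≡C , B<C) with <-cmp d d′
... | tri< d<d′ _ _ =
  d , (λ i i<d → trans (A≡B i i<d) (B≡C i (<-trans i<d d<d′))) , subst (A d <⟨ odd? d ⟩_) (B≡C d d<d′) A<B
... | tri≈ _ refl _ =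
  d , (λ i i<d → trans (A≡B i i<d) (B≡C i i<d)) , <⟨⟩-trans (odd? d) A<B B<C
... | tri> _ _ d′<d =
  d′ , (λ i i<d′ → trans (A≡B i (<-trans i<d′ d′<d)) (B≡C i i<d′)) ,
  subst (_<⟨ odd? d′ ⟩ C d′) (sym (A≡B d′ d′<d)) B<C

≺-cong : ∀ {A A′ B B′ d} → (∀ i → i ≤ d → A i ≡ A′ i) → (∀ i → i ≤ d → B i ≡ B′ i) →
  A ≺[ d ] B → A′ ≺[ d ] B′
≺-cong {d = d} A≡A′ B≡B′ (A≡B , A<B) =
  (λ i i<d → trans (sym (A≡A′ i (<⇒≤ i<d))) (trans (A≡B i i<d) (B≡B′ i (<⇒≤ i<d)))) ,
  subst₂ (_<⟨ odd? d ⟩_) (A≡A′ d ≤-refl) (B≡B′ d ≤-refl) A<B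

≺-shift : ∀ {A B} r {e} → odd? r ≡ false → A ≺[ r + e ] B → (A ∘ (r +_)) ≺[ e ] (B ∘ (r +_))
≺-shift {A} {B} r {e} r-even (A≡B , A<B) =
  (λ i i<e → A≡B (r + i) (+-monoʳ-< r i<e)) ,
  subst (A (r + e) <⟨_⟩ B (r + e)) (trans (odd?-+ r e) (cong (_xor odd? e) r-even)) A<B

Periodic : ℕ → Seq → Set
Periodic k A = ∀ i → A (k + i) ≡ A i

shift-periodic : ∀ {k A} s → Periodic k A → Periodic k (A ∘ (s +_))
shift-periodic {k} {A} s A-per i = trans (cong A (x∙yz≈y∙xz +-commutativeSemigroup s k i)) (A-per (s + i))

periodic-+ : ∀ {k l A} → Periodic k A → Periodic l A → Periodic (k + l) A
periodic-+ {k} {l} {A} A-perₖ A-perₗ i = trans (cong A (+-assoc k l i)) (trans (A-perₖ (l + i)) (A-perₗ i))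

periodic-agree-extend : ∀ {k} {A B : Seq} → 1 ≤ k → Periodic k A → (∀ i → i < k → A i ≡ B i) →
  ∀ e → (∀ i → i < e → B (k + i) ≡ B i) → ∀ i → i < k + e → A i ≡ B i
periodic-agree-extend {k} k≥1 A-per A≡B zero _ i i<k+0 = A≡B i (subst (i <_) (+-identityʳ k) i<k+0)
periodic-agree-extend {k} {A} {B} k≥1 A-per A≡B (suc e) B-per i i<k+1+e =
  [ A≡B-below i , (λ i≡k+e → subst (λ j → A j ≡ B j) (sym i≡k+e) A≡B-at ) ]′
    (m<1+n⇒m<n∨m≡n (subst (i <_) (+-suc k e) i<k+1+e))
  where
  A≡B-below : ∀ i → i < k + e → A i ≡ B i
  A≡B-below = periodic-agree-extend k≥1 A-per A≡B e (λ j j<e → B-per j (m<n⇒m<1+n j<e))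
  A≡B-at : A (k + e) ≡ B (k + e)
  A≡B-at = begin
    A (k + e) ≡⟨ A-per e ⟩
    A e       ≡⟨ A≡B-below e (m<n+m e k≥1) ⟩
    B e       ≡⟨ B-per e ≤-refl ⟨
    B (k + e) ∎

periodic-ext : ∀ {k A B} → 1 ≤ k → Periodic k A → Periodic k B → (∀ i → i < k → A i ≡ B i) →
  ∀ i → A i ≡ B i
periodic-ext {k} {A} {B} k≥1 A-per B-per A≡B i =
  periodic-agree-extend k≥1 A-per A≡B (suc i) (λ j _ → B-per j) i (m≤n+m (suc i) k)

≺-periodic-bound : ∀ {k A B d} → 1 ≤ k → Periodic k A → Periodic k B → A ≺[ d ] B → d < k
≺-periodic-bound {k} {d = d} k≥1 A-per B-per A≺B with d <? k
... | yes d<k = d<k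
... | no  d≮k = contradiction
  (periodic-ext k≥1 A-per B-per (λ i i<k → proj₁ A≺B i (<-≤-trans i<k (≮⇒≥ d≮k))) d) (≺⇒≢ A≺B)

-- A is (B[0..k))^ω. It agrees with B below k + e, and A (k + e) = B e is compared with B (k + e).
power-of-prefix-≺ : ∀ {k e} {A B : Seq} → 1 ≤ k → Periodic k A → (∀ i → i < k → A i ≡ B i) →
  B ≺[ e ] (B ∘ (k +_)) →
  (odd? k ≡ false → A ≺[ k + e ] B) × (odd? k ≡ true → B ≺[ k + e ] A)
power-of-prefix-≺ {k} {e} {A} {B} k≥1 A-per A≡B (B≡Bₖ , B<Bₖ) = even-k , odd-k
  where
  A≡B-below : ∀ i → i < k + e → A i ≡ B i
  A≡B-below = periodic-agree-extend k≥1 A-per A≡B e (λ i i<e → sym (B≡Bₖ i i<e))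
  A≡B-at : A (k + e) ≡ B e
  A≡B-at = trans (A-per e) (A≡B-below e (m<n+m e k≥1))
  parity : ∀ {b} → odd? k ≡ b → odd? (k + e) ≡ b xor odd? e
  parity k-parity = trans (odd?-+ k e) (cong (_xor odd? e) k-parity)
  even-k : odd? k ≡ false → A ≺[ k + e ] B
  even-k k-even = A≡B-below , subst₂ (_<⟨_⟩ B (k + e)) (sym A≡B-at) (sym (parity k-even)) B<Bₖ
  odd-k : odd? k ≡ true → B ≺[ k + e ] A
  odd-k k-odd = (λ i i<k+e → sym (A≡B-below i i<k+e)) ,
    subst₂ (B (k + e) <⟨_⟩_) (sym (parity k-odd)) (sym A≡B-at) (<⟨⟩-flip (odd? e) B<Bₖ)

nth-take : ∀ (W : Word) {k i} → i < k → nth (take k W) i ≡ nth W i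
nth-take []      {suc k} _           = refl
nth-take (x ∷ W) {suc k} {zero}  _   = refl
nth-take (x ∷ W) {suc k} {suc i} i<k = nth-take W (≤-pred i<k)

nth-drop : ∀ (W : Word) k i → nth (drop k W) i ≡ nth W (k + i)
nth-drop W       zero    i = refl
nth-drop []      (suc k) i = refl
nth-drop (x ∷ W) (suc k) i = nth-drop W k i

nth-++ˡ : ∀ (X Y : Word) {i} → i < length X → nth (X ++ Y) i ≡ nth X i
nth-++ˡ (x ∷ X) Y {zero}  _   = refl
nth-++ˡ (x ∷ X) Y {suc i} i<n = nth-++ˡ X Y (≤-pred i<n)

length-take≤ : ∀ (W : Word) {k} → k ≤ length W → length (take k W) ≡ k
length-take≤ W {k} k≤n = trans (length-take k W) (m≤n⇒m⊓n≡m k≤n)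

take-cong : ∀ k (X Y : Word) → k ≤ length X → k ≤ length Y → (∀ i → i < k → nth X i ≡ nth Y i) →
  take k X ≡ take k Y
take-cong zero    X       Y       _          _          _   = refl
take-cong (suc k) (x ∷ X) (y ∷ Y) (s≤s k≤|X|) (s≤s k≤|Y|) X≡Y =
  cong₂ _∷_ (X≡Y 0 z<s) (take-cong k X Y k≤|X| k≤|Y| (λ i i<k → X≡Y (suc i) (s≤s i<k)))

nonempty : ∀ {W : Word} → 1 ≤ length W → W ≢ []
nonempty {_ ∷ _} _ ()

omega-nth : ∀ (W : Word) {i} → i < length W → omega W i ≡ nth W i
omega-nth (x ∷ W) i<n = cong (nth (x ∷ W)) (m<n⇒m%n≡m i<n)

<-length-drop : ∀ (W : Word) s i → s + i < length W → i < length (drop s W)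
<-length-drop W s i s+i<n =
  subst (i <_) (sym (length-drop s W)) (m+n≤o⇒m≤o∸n (suc i) (subst (_≤ length W) (cong suc (+-comm s i)) s+i<n))

omega-drop : ∀ (W : Word) s i → s + i < length W → omega (drop s W) i ≡ nth W (s + i)
omega-drop W s i s+i<n = trans (omega-nth (drop s W) (<-length-drop W s i s+i<n)) (nth-drop W s i)

omega-periodic : ∀ (W : Word) {k} → length W ≡ k → 1 ≤ k → Periodic k (omega W)
omega-periodic (x ∷ W) refl _ i =
  cong (nth (x ∷ W)) (trans (cong (_% suc (length W)) (+-comm (suc (length W)) i)) ([m+n]%n≡m%n i (suc (length W))))

≺alt⇒≺ : ∀ {X Y : Word} → Y ≢ [] → X ≺alt Y → ∃[ d ] omega X ≺[ d ] omega Y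
≺alt⇒≺ Y≢[] (inj₁ (_ , Y≡[])) = contradiction Y≡[] Y≢[]
≺alt⇒≺ {X} {Y} _ (inj₂ (_ , _ , d , X≡Y , inj₁ (d-even , X<Y))) =
  d , X≡Y , subst (omega X d <⟨_⟩ omega Y d) (sym (IsEven⇒odd? d d-even)) X<Y
≺alt⇒≺ {X} {Y} _ (inj₂ (_ , _ , d , X≡Y , inj₂ (d-odd , Y<X))) =
  d , X≡Y , subst (omega X d <⟨_⟩ omega Y d) (sym (IsOdd⇒odd? d d-odd)) Y<X

≺⇒≺alt : ∀ {X Y : Word} {d} → X ≢ [] → Y ≢ [] → omega X ≺[ d ] omega Y → X ≺alt Y
≺⇒≺alt {d = d} X≢[] Y≢[] (X≡Y , X<Y) with odd? d in d-parity
... | false = inj₂ (X≢[] , Y≢[] , d , X≡Y , inj₁ (odd?⇒IsEven d d-parity , X<Y))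
... | true  = inj₂ (X≢[] , Y≢[] , d , X≡Y , inj₂ (odd?⇒IsOdd d d-parity , X<Y))

≺⇒¬⪯alt : ∀ {X Y : Word} {d} → X ≢ [] → Y ≢ [] → omega X ≺[ d ] omega Y → ¬ Y ⪯alt X
≺⇒¬⪯alt X≢[] Y≢[] X≺Y (inj₁ Y≺altX) = ≺-asym X≺Y (proj₂ (≺alt⇒≺ X≢[] Y≺altX))
≺⇒¬⪯alt X≢[] Y≢[] X≺Y (inj₂ (inj₁ (Y≡[] , _))) = Y≢[] Y≡[]
≺⇒¬⪯alt {d = d} X≢[] Y≢[] X≺Y (inj₂ (inj₂ (_ , _ , Y≗X))) = ≺⇒≢ X≺Y (sym (Y≗X d))

¬SPrefCond-even : ∀ {W P : Word} {d} → W ≢ [] → P ≢ [] → odd? (length P) ≡ false →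
  omega P ≺[ d ] omega W → ¬ SPrefCond W P
¬SPrefCond-even W≢[] P≢[] _ P≺W (inj₁ (_ , W⪯P)) = ≺⇒¬⪯alt P≢[] W≢[] P≺W W⪯P
¬SPrefCond-even {P = P} _ _ P-even _ (inj₂ (P-odd , _)) =
  contradiction (trans (sym P-even) (IsOdd⇒odd? (length P) P-odd)) λ ()

¬SPrefCond-odd : ∀ {W P : Word} {d} → W ≢ [] → P ≢ [] → odd? (length P) ≡ true →
  omega W ≺[ d ] omega P → ¬ SPrefCond W P
¬SPrefCond-odd W≢[] P≢[] _ W≺P (inj₂ (_ , P⪯W)) = ≺⇒¬⪯alt W≢[] P≢[] W≺P P⪯W
¬SPrefCond-odd {P = P} _ _ P-odd _ (inj₁ (P-even , _)) =
  contradiction (trans (sym P-odd) (IsEven⇒odd? (length P) P-even)) λ ()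

≺alt-at-last : ∀ {X Y : Word} {m} → length X ≡ suc m → length Y ≡ suc m →
  (∀ i → i < m → nth X i ≡ nth Y i) → X ≺alt Y → omega X ≺[ m ] omega Y
≺alt-at-last {X} {Y} {m} |X| |Y| X≡Y X≺Y with ≺alt⇒≺ (nonempty (subst (1 ≤_) (sym |Y|) z<s)) X≺Y
... | d , X≺[d]Y
  with m<1+n⇒m<n∨m≡n {n = m} (≺-periodic-bound z<s (omega-periodic X |X| z<s) (omega-periodic Y |Y| z<s) X≺[d]Y)
...   | inj₂ refl = X≺[d]Y
...   | inj₁ d<m  = contradiction X≡Y-at (≺⇒≢ X≺[d]Y)
  where
  d<suc-m : d < suc m
  d<suc-m = m<n⇒m<1+n d<m
  X≡Y-at : omega X d ≡ omega Y d
  X≡Y-at = begin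
    omega X d ≡⟨ omega-nth X (subst (d <_) (sym |X|) d<suc-m) ⟩
    nth X d   ≡⟨ X≡Y d d<m ⟩
    nth Y d   ≡⟨ omega-nth Y (subst (d <_) (sym |Y|) d<suc-m) ⟨
    omega Y d ∎

module _ {Q : Seq} {p : ℕ} (p-odd : odd? p ≡ true) (Q-per : Periodic p Q)
         (Q≺rotation : ∀ s → 1 ≤ s → s < p → ∃[ e ] Q ≺[ e ] (Q ∘ (s +_))) where

  private
    p≥1 : 1 ≤ p
    p≥1 = odd?⇒1≤ p-odd

  rotation-bound : ∀ {s e} → Q ≺[ e ] (Q ∘ (s +_)) → e < p
  rotation-bound {s} = ≺-periodic-bound p≥1 Q-per (shift-periodic s Q-per)

  -- If e ≥ p - s, shifting by the even r = p - s would put Q ∘ (r +_) below Q.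
  odd-rotation-bound : ∀ {s e} → odd? s ≡ true → s < p → Q ≺[ e ] (Q ∘ (s +_)) → s + e < p
  odd-rotation-bound {s} {e} s-odd s<p Q≺Qₛ with e <? p ∸ s
  ... | yes e<p∸s = subst (s + e <_) (m+[n∸m]≡n (<⇒≤ s<p)) (+-monoʳ-< s e<p∸s)
  ... | no  e≮p∸s = contradiction Qᵣ≺Q (≺-asym (proj₂ (Q≺rotation r (m<n⇒0<n∸m s<p) r<p)))
    where
    r : ℕ
    r = p ∸ s
    s+r≡p : s + r ≡ p
    s+r≡p = m+[n∸m]≡n (<⇒≤ s<p)
    r<p : r < p
    r<p = ∸-monoʳ-< (odd?⇒1≤ s-odd) (<⇒≤ s<p)
    r-even : odd? r ≡ false
    r-even = not-injective (begin
      true xor odd? r  ≡⟨ cong (_xor odd? r) s-odd ⟨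
      odd? s xor odd? r ≡⟨ odd?-+ s r ⟨
      odd? (s + r)      ≡⟨ cong odd? s+r≡p ⟩
      odd? p            ≡⟨ p-odd ⟩
      true              ∎)
    Qₛ₊ᵣ≡Q : ∀ i → Q (s + (r + i)) ≡ Q i
    Qₛ₊ᵣ≡Q i = trans (cong Q (trans (sym (+-assoc s r i)) (cong (_+ i) s+r≡p))) (Q-per i)
    Qᵣ≺Q : (Q ∘ (r +_)) ≺[ e ∸ r ] Q
    Qᵣ≺Q = ≺-cong (λ _ _ → refl) (λ i _ → Qₛ₊ᵣ≡Q i)
      (≺-shift r r-even (subst (λ d → Q ≺[ d ] (Q ∘ (s +_))) (sym (m+[n∸m]≡n (≮⇒≥ e≮p∸s))) Q≺Qₛ))

  rotation-beyond-period : ∀ {s} → 1 ≤ s → s < p →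
    ∃[ e ] Q ≺[ e ] (Q ∘ ((p + s) +_)) × (odd? (p + s) ≡ false → p + s + e < p + p)
  rotation-beyond-period {s} s≥1 s<p =
    let (e , Q≺Qₛ) = Q≺rotation s s≥1 s<p in
    e , ≺-cong (λ _ _ → refl) (λ i _ → sym (Qₚ₊ₛ≡Qₛ i)) Q≺Qₛ ,
    λ p+s-even → subst (_< p + p) (sym (+-assoc p s e)) (+-monoʳ-< p (odd-rotation-bound (s-odd p+s-even) s<p Q≺Qₛ))
    where
    Qₚ₊ₛ≡Qₛ : ∀ i → Q (p + s + i) ≡ Q (s + i)
    Qₚ₊ₛ≡Qₛ i = trans (cong Q (+-assoc p s i)) (Q-per (s + i))
    s-odd : odd? (p + s) ≡ false → odd? s ≡ true
    s-odd p+s-even = not-injective (begin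
      true xor odd? s   ≡⟨ cong (_xor odd? s) p-odd ⟨
      odd? p xor odd? s ≡⟨ odd?-+ p s ⟨
      odd? (p + s)      ≡⟨ p+s-even ⟩
      false             ∎)

  rotation-below-2p : ∀ {k} → 1 ≤ k → k < p + p → k ≢ p →
    ∃[ e ] Q ≺[ e ] (Q ∘ (k +_)) × (odd? k ≡ false → k + e < p + p)
  rotation-below-2p {k} k≥1 k<2p k≢p with <-cmp k p
  ... | tri< k<p _ _ =
    let (e , Q≺Qₖ) = Q≺rotation k k≥1 k<p in e , Q≺Qₖ , λ _ → +-mono-< k<p (rotation-bound Q≺Qₖ)
  ... | tri≈ _ k≡p _ = contradiction k≡p k≢p
  ... | tri> _ _ p<k =
    subst (λ k → ∃[ e ] Q ≺[ e ] (Q ∘ (k +_)) × (odd? k ≡ false → k + e < p + p)) (m+[n∸m]≡n (<⇒≤ p<k))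
      (rotation-beyond-period (m<n⇒0<n∸m p<k) (subst (k ∸ p <_) (m+n∸m≡n p p) (∸-monoˡ-< k<2p (<⇒≤ p<k))))

  prefix-power-vs-Q : ∀ {k} {A : Seq} → 1 ≤ k → k < p + p → k ≢ p → Periodic k A → (∀ i → i < k → A i ≡ Q i) →
    (odd? k ≡ false → ∃[ d ] d < p + p × A ≺[ d ] Q) × (odd? k ≡ true → ∃[ d ] Q ≺[ d ] A)
  prefix-power-vs-Q {k} k≥1 k<2p k≢p A-per A≡Q =
    let (e , Q≺Qₖ , bound) = rotation-below-2p k≥1 k<2p k≢p
        (A≺Q , Q≺A)        = power-of-prefix-≺ k≥1 A-per A≡Q Q≺Qₖ
    in (λ k-even → k + e , bound k-even , A≺Q k-even) , (λ k-odd → k + e , Q≺A k-odd)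

  module _ (V : Word) {m} (2p≤m : p + p ≤ m) (m<|V| : m < length V) (V≡Q : ∀ i → i < m → nth V i ≡ Q i)
           (V≺Q : omega V ≺[ m ] Q) where

    private
      2p≤|V| : p + p ≤ length V
      2p≤|V| = ≤-trans 2p≤m (<⇒≤ m<|V|)
      V≢[] : V ≢ []
      V≢[] = nonempty (≤-trans (s≤s z≤n) m<|V|)
      V≗Q : ∀ {i} → i < m → omega V i ≡ Q i
      V≗Q {i} i<m = trans (omega-nth V (<-trans i<m m<|V|)) (V≡Q i i<m)
      |prefix| : ∀ {k} → k ≤ p + p → length (take k V) ≡ k
      |prefix| k≤2p = length-take≤ V (≤-trans k≤2p 2p≤|V|)
      prefix-nonempty : ∀ {k} → 1 ≤ k → k ≤ p + p → take k V ≢ []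
      prefix-nonempty k≥1 k≤2p = nonempty (subst (1 ≤_) (sym (|prefix| k≤2p)) k≥1)
      prefix-periodic : ∀ {k} → 1 ≤ k → k ≤ p + p → Periodic k (omega (take k V))
      prefix-periodic {k} k≥1 k≤2p = omega-periodic (take k V) (|prefix| k≤2p) k≥1
      prefix≡Q : ∀ {k} → k ≤ p + p → ∀ i → i < k → omega (take k V) i ≡ Q i
      prefix≡Q {k} k≤2p i i<k = begin
        omega (take k V) i ≡⟨ omega-nth (take k V) (subst (i <_) (sym (|prefix| k≤2p)) i<k) ⟩
        nth (take k V) i   ≡⟨ nth-take V i<k ⟩
        nth V i            ≡⟨ V≡Q i (<-≤-trans i<k (≤-trans k≤2p 2p≤m)) ⟩
        Q i                ∎
      prefix≗Q : ∀ {k} → 1 ≤ k → k ≤ p + p → Periodic k Q → ∀ i → omega (take k V) i ≡ Q i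
      prefix≗Q k≥1 k≤2p Q-perₖ = periodic-ext k≥1 (prefix-periodic k≥1 k≤2p) Q-perₖ (prefix≡Q k≤2p)
      2p≥1 : 1 ≤ p + p
      2p≥1 = ≤-trans p≥1 (m≤m+n p p)
      |square| : length (take (p + p) V) ≡ p + p
      |square| = |prefix| ≤-refl

    square-satisfies-SPrefCond : SPrefCond V (take (p + p) V)
    square-satisfies-SPrefCond =
      inj₁ (odd?⇒IsEven (length (take (p + p) V)) (trans (cong odd? |square|) 2p-even) ,
            inj₁ (≺⇒≺alt V≢[] (prefix-nonempty 2p≥1 ≤-refl) (≺-cong (λ _ _ → refl) square≗Q V≺Q)))
      where
      2p-even : odd? (p + p) ≡ false
      2p-even = trans (odd?-+ p p) (cong (λ b → b xor b) p-odd)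
      square≗Q : ∀ i → i ≤ m → Q i ≡ omega (take (p + p) V) i
      square≗Q i _ = sym (prefix≗Q 2p≥1 ≤-refl (periodic-+ Q-per Q-per) i)

    shorter-prefix-fails : ∀ {k} → 1 ≤ k → k < p + p → ¬ SPrefCond V (take k V)
    shorter-prefix-fails {k} k≥1 k<2p = by-cases (k ≟ p)
      where
      k≤2p : k ≤ p + p
      k≤2p = <⇒≤ k<2p
      P≢[] : take k V ≢ []
      P≢[] = prefix-nonempty k≥1 k≤2p
      |P|-parity : odd? (length (take k V)) ≡ odd? k
      |P|-parity = cong odd? (|prefix| k≤2p)
      by-cases : Dec (k ≡ p) → ¬ SPrefCond V (take k V)
      by-cases (yes k≡p) =
        ¬SPrefCond-odd V≢[] P≢[] (trans |P|-parity (trans (cong odd? k≡p) p-odd))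
          (≺-cong (λ _ _ → refl) (λ i _ → sym (prefix≗Q k≥1 k≤2p Q-perₖ i)) V≺Q)
        where
        Q-perₖ : Periodic k Q
        Q-perₖ = subst (λ l → Periodic l Q) (sym k≡p) Q-per
      by-cases (no k≢p) with odd? k in k-parity
                             | prefix-power-vs-Q k≥1 k<2p k≢p (prefix-periodic k≥1 k≤2p) (prefix≡Q k≤2p)
      ... | false | (even-k , _) =
        let (d , d<2p , P≺Q) = even-k refl in
        ¬SPrefCond-even V≢[] P≢[] (trans |P|-parity k-parity)
          (≺-cong (λ _ _ → refl) (λ i i≤d → sym (V≗Q (<-≤-trans (≤-<-trans i≤d d<2p) 2p≤m))) P≺Q)
      ... | true  | (_ , odd-k) =
        let (_ , Q≺P) = odd-k refl in
        ¬SPrefCond-odd V≢[] P≢[] (trans |P|-parity k-parity) (proj₂ (≺-trans V≺Q Q≺P))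

    square-is-SPref : IsSPref V (take (p + p) V)
    square-is-SPref =
      subst (1 ≤_) (sym |square|) 2p≥1 ,
      subst (_≤ length V) (sym |square|) 2p≤|V| ,
      cong (λ l → take l V) (sym |square|) ,
      square-satisfies-SPrefCond ,
      λ k k≥1 k<|square| → shorter-prefix-fails k≥1 (subst (k <_) |square| k<|square|)

period-difference : ∀ {W : Word} {q r} → IsPeriod W q → IsPeriod W (q + r) → 1 ≤ r → q + r + q ≤ length W →
  IsPeriod W r
period-difference {W} {q} {r} (_ , _ , q-per) (_ , q+r≤n , q+r-per) r≥1 q+r+q≤n =
  r≥1 , ≤-trans (m≤n+m r q) q+r≤n , r-per
  where
  q≤i : ∀ {i} → ¬ i + (q + r) < length W → q ≤ i
  q≤i {i} i+q+r≮n =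
    +-cancelˡ-≤ (q + r) q i (≤-trans q+r+q≤n (subst (length W ≤_) (+-comm i (q + r)) (≮⇒≥ i+q+r≮n)))
  r-per : ∀ i → i + r < length W → nth W (i + r) ≡ nth W i
  r-per i i+r<n with i + (q + r) <? length W
  ... | yes i+q+r<n = begin
    nth W (i + r)       ≡⟨ q-per (i + r) (subst (_< length W) i+q+r≡ i+q+r<n) ⟨
    nth W (i + r + q)   ≡⟨ cong (nth W) (sym i+q+r≡) ⟩
    nth W (i + (q + r)) ≡⟨ q+r-per i i+q+r<n ⟩
    nth W i             ∎
    where
    i+q+r≡ : i + (q + r) ≡ i + r + q
    i+q+r≡ = trans (cong (i +_) (+-comm q r)) (sym (+-assoc i r q))
  ... | no i+q+r≮n with i ∸ q | m∸n+n≡m (q≤i {i} i+q+r≮n)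
  ...   | j | refl = begin
    nth W (j + q + r)   ≡⟨ cong (nth W) (+-assoc j q r) ⟩
    nth W (j + (q + r)) ≡⟨ q+r-per j (subst (_< length W) (+-assoc j q r) i+r<n) ⟩
    nth W j             ≡⟨ q-per j (≤-<-trans (m≤m+n (j + q) r) i+r<n) ⟨
    nth W (j + q)       ∎

odd-period-is-least : ∀ {W : Word} {p} → IsOdd p → IsPeriod W p → (∀ r → r < p → IsOdd r → ¬ IsPeriod W r) →
  p + p ≤ length W → ∀ s → s < p → ¬ IsPeriod W s
odd-period-is-least {W} {p} p-odd p-per p-least-odd 2p≤n s s<p s-per with odd? s in s-parity
... | true  = p-least-odd s s<p (odd?⇒IsOdd s s-parity) s-per
... | false = p-least-odd r r<p (odd?⇒IsOdd r r-odd)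
                (period-difference {W} s-per (subst (IsPeriod W) (sym s+r≡p) p-per) (m<n⇒0<n∸m s<p) s+r+s≤n)
  where
  r : ℕ
  r = p ∸ s
  s+r≡p : s + r ≡ p
  s+r≡p = m+[n∸m]≡n (<⇒≤ s<p)
  r<p : r < p
  r<p = ∸-monoʳ-< (proj₁ s-per) (<⇒≤ s<p)
  r-odd : odd? r ≡ true
  r-odd = begin
    odd? r            ≡⟨ cong (_xor odd? r) s-parity ⟨
    odd? s xor odd? r ≡⟨ odd?-+ s r ⟨
    odd? (s + r)      ≡⟨ cong odd? s+r≡p ⟩
    odd? p            ≡⟨ IsOdd⇒odd? p p-odd ⟩
    true              ∎
  s+r+s≤n : s + r + s ≤ length W
  s+r+s≤n = subst (_≤ length W) (cong (_+ s) (sym s+r≡p)) (≤-trans (+-monoʳ-≤ p (<⇒≤ s<p)) 2p≤n)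

module PreGaloisWord {T : Word} {p : ℕ} (T-preGalois : PreGalois T) (p-odd : IsOdd p) (p-per : IsPeriod T p)
       (p-least-odd : ∀ r → r < p → IsOdd r → ¬ IsPeriod T r) (2p≤n : p + p ≤ length T) where

  private
    p≥1 : 1 ≤ p
    p≥1 = proj₁ p-per
    p≤n : p ≤ length T
    p≤n = proj₁ (proj₂ p-per)
    |T↾p| : length (take p T) ≡ p
    |T↾p| = length-take≤ T p≤n
    s+i<n : ∀ {s i} → s < p → i < p → s + i < length T
    s+i<n s<p i<p = <-≤-trans (+-mono-< s<p i<p) 2p≤n

  Q : Seq
  Q = omega (take p T)

  Q-per : Periodic p Q
  Q-per = omega-periodic (take p T) |T↾p| p≥1

  Q≡T : ∀ {i} → i < length T → Q i ≡ nth T i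
  Q≡T {i} i<n =
    periodic-agree-extend p≥1 Q-per Q≡T-below (length T ∸ p) T-per i (subst (i <_) (sym (m+[n∸m]≡n p≤n)) i<n)
    where
    Q≡T-below : ∀ i → i < p → Q i ≡ nth T i
    Q≡T-below i i<p = trans (omega-nth (take p T) (subst (i <_) (sym |T↾p|) i<p)) (nth-take T i<p)
    T-per : ∀ i → i < length T ∸ p → nth T (p + i) ≡ nth T i
    T-per i i<n∸p = trans (cong (nth T) (+-comm p i)) (proj₂ (proj₂ p-per) i (m≤o∸n⇒m+n≤o (suc i) p≤n i<n∸p))

  Qₛ≢Q : ∀ {s} → 1 ≤ s → s < p → ¬ (∀ i → i < p → Q (s + i) ≡ Q i)
  Qₛ≢Q {s} s≥1 s<p Qₛ≡Q =
    odd-period-is-least {T} p-odd p-per p-least-odd 2p≤n s s<p (s≥1 , ≤-trans (<⇒≤ s<p) p≤n , s-per)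
    where
    s-per : ∀ i → i + s < length T → nth T (i + s) ≡ nth T i
    s-per i i+s<n = begin
      nth T (i + s) ≡⟨ Q≡T i+s<n ⟨
      Q (i + s)     ≡⟨ cong Q (+-comm i s) ⟩
      Q (s + i)     ≡⟨ periodic-ext p≥1 (shift-periodic s Q-per) Q-per Qₛ≡Q i ⟩
      Q i           ≡⟨ Q≡T (≤-<-trans (m≤m+n i s) i+s<n) ⟩
      nth T i       ∎

  Q≺rotation : ∀ s → 1 ≤ s → s < p → ∃[ e ] Q ≺[ e ] (Q ∘ (s +_))
  Q≺rotation s s≥1 s<p with T-preGalois s s≥1 (≤-trans (<⇒≤ s<p) p≤n)
  ... | inj₁ (R , T≡Tₛ++R) = contradiction Qₛ≡Q (Qₛ≢Q s≥1 s<p)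
    where
    Qₛ≡Q : ∀ i → i < p → Q (s + i) ≡ Q i
    Qₛ≡Q i i<p = begin
      Q (s + i)                ≡⟨ Q≡T (s+i<n s<p i<p) ⟩
      nth T (s + i)            ≡⟨ nth-drop T s i ⟨
      nth (drop s T) i         ≡⟨ nth-++ˡ (drop s T) R (<-length-drop T s i (s+i<n s<p i<p)) ⟨
      nth (drop s T ++ R) i    ≡⟨ cong (λ W → nth W i) T≡Tₛ++R ⟨
      nth T i                  ≡⟨ Q≡T (<-≤-trans i<p p≤n) ⟨
      Q i                      ∎
  ... | inj₂ T≺Tₛ with ≺alt⇒≺ (nonempty (<-length-drop T s 0 (s+i<n s<p p≥1))) T≺Tₛ
  ...   | j , T≺[j]Tₛ with j <? p
  ...     | yes j<p =
    j , ≺-cong (λ i i≤j → omega-T (≤-<-trans i≤j j<p)) (λ i i≤j → omega-Tₛ (≤-<-trans i≤j j<p)) T≺[j]Tₛ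
    where
    omega-T : ∀ {i} → i < p → omega T i ≡ Q i
    omega-T i<p = trans (omega-nth T (<-≤-trans i<p p≤n)) (sym (Q≡T (<-≤-trans i<p p≤n)))
    omega-Tₛ : ∀ {i} → i < p → omega (drop s T) i ≡ Q (s + i)
    omega-Tₛ {i} i<p = trans (omega-drop T s i (s+i<n s<p i<p)) (sym (Q≡T (s+i<n s<p i<p)))
  ...     | no j≮p = contradiction Qₛ≡Q (Qₛ≢Q s≥1 s<p)
    where
    Qₛ≡Q : ∀ i → i < p → Q (s + i) ≡ Q i
    Qₛ≡Q i i<p = begin
      Q (s + i)            ≡⟨ Q≡T (s+i<n s<p i<p) ⟩
      nth T (s + i)        ≡⟨ omega-drop T s i (s+i<n s<p i<p) ⟨
      omega (drop s T) i   ≡⟨ proj₁ T≺[j]Tₛ i (<-≤-trans i<p (≮⇒≥ j≮p)) ⟨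
      omega T i            ≡⟨ omega-nth T (<-≤-trans i<p p≤n) ⟩
      nth T i              ≡⟨ Q≡T (<-≤-trans i<p p≤n) ⟨
      Q i                  ∎

  module Appended (z : ℕ) where

    T′ V U : Word
    T′ = T ++ [ z ]
    V  = drop p T′
    U  = take (length T ∸ p + 1) T′

    m : ℕ
    m = length T ∸ p

    private
      m<n : m < length T
      m<n = ∸-monoʳ-< p≥1 p≤n
      |T′| : length T′ ≡ length T + 1
      |T′| = length-++ T
      |V| : length V ≡ suc m
      |V| = trans (length-drop p T′) (trans (cong (_∸ p) |T′|) (trans (+-∸-comm 1 p≤n) (+-comm m 1)))
      |U| : length U ≡ suc m
      |U| = trans (length-take≤ T′ (subst (m + 1 ≤_) (sym |T′|) (+-monoˡ-≤ 1 (<⇒≤ m<n)))) (+-comm m 1)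
      U≡T : ∀ {i} → i ≤ m → nth U i ≡ nth T i
      U≡T {i} i≤m =
        trans (nth-take T′ (subst (i <_) (+-comm 1 m) (s≤s i≤m))) (nth-++ˡ T [ z ] (≤-<-trans i≤m m<n))

    V≡Q : ∀ i → i < m → nth V i ≡ Q i
    V≡Q i i<m = begin
      nth V i        ≡⟨ nth-drop T′ p i ⟩
      nth T′ (p + i) ≡⟨ nth-++ˡ T [ z ] p+i<n ⟩
      nth T (p + i)  ≡⟨ Q≡T p+i<n ⟨
      Q (p + i)      ≡⟨ Q-per i ⟩
      Q i            ∎
      where
      p+i<n : p + i < length T
      p+i<n = subst (_< length T) (+-comm i p) (m≤o∸n⇒m+n≤o (suc i) p≤n i<m)

    V≺Q : V ≺alt U → omega V ≺[ m ] Q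
    V≺Q V≺U = ≺-cong (λ _ _ → refl) omega-U≡Q (≺alt-at-last |V| |U| V≡U V≺U)
      where
      V≡U : ∀ i → i < m → nth V i ≡ nth U i
      V≡U i i<m = trans (V≡Q i i<m) (trans (Q≡T (<-trans i<m m<n)) (sym (U≡T (<⇒≤ i<m))))
      omega-U≡Q : ∀ i → i ≤ m → omega U i ≡ Q i
      omega-U≡Q i i≤m =
        trans (omega-nth U (subst (i <_) (sym |U|) (s≤s i≤m))) (trans (U≡T i≤m) (sym (Q≡T (≤-<-trans i≤m m<n))))

    SPref-of-suffix-is-square : p + p ≤ m → V ≺alt U → IsSPref V (take (p + p) V)
    SPref-of-suffix-is-square 2p≤m V≺U =
      square-is-SPref (IsOdd⇒odd? p p-odd) Q-per Q≺rotation V 2p≤m (subst (m <_) (sym |V|) ≤-refl) V≡Q (V≺Q V≺U)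

    square-is-prefix : p + p ≤ m → take (p + p) V ≡ take (p + p) T′
    square-is-prefix 2p≤m = take-cong (p + p) V T′ (subst (p + p ≤_) (sym |V|) (m≤n⇒m≤1+n 2p≤m))
      (≤-trans (≤-trans 2p≤m (<⇒≤ m<n)) (subst (length T ≤_) (sym |T′|) (m≤m+n (length T) 1)))
      (λ i i<2p → let i<m = <-≤-trans i<2p 2p≤m in
        trans (V≡Q i i<m) (trans (Q≡T (<-trans i<m m<n)) (sym (nth-++ˡ T [ z ] (<-trans i<m m<n)))))

factor-from : ∀ (W : Word) q j → factor W (q + 1) j ≡ take (j ∸ q) (drop q W)
factor-from W q j rewrite +-comm q 1 = refl

factor-suffix : ∀ (W : Word) q → factor W (q + 1) (length W) ≡ drop q W
factor-suffix W q =
  trans (factor-from W q (length W)) (take-all (length W ∸ q) (drop q W) (≤-reflexive (length-drop q W)))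

lemma30 : (T : Word) → PreGalois T → (po pe : ℕ) → IsPerO T po → IsPerE T pe →
    (z : ℕ) → (T' : Word) → T' ≡ T ++ [ z ] →
    factor T' (po + 1) (length T + 1) ≺alt factor T' 1 (length T ∸ po + 1) →
    (p : ℕ) → IsSPref T' (factor T' 1 p) →
    p ≡ po → 3 * p ≤ length T →
    IsSPref (factor T' (p + 1) (length T')) (factor T' (p + 1) (3 * p))
    × factor T' (p + 1) (3 * p) ≡ factor T' 1 (2 * p)
lemma30 T _ po _ (inj₂ (_ , po≡n+1)) _ _ _ _ _ .po _ refl 3po≤n =
  contradiction (subst (_≤ length T) po≡n+1 (≤-trans (m≤m+n po (2 * po)) 3po≤n)) (n≮n (length T))
lemma30 T T-preGalois p _ (inj₁ (p-odd , p-per , p-least-odd)) _ z .(T ++ [ z ]) refl suffix≺prefix .p _ refl 3p≤n =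
  subst₂ IsSPref (sym (factor-suffix T′ p)) (sym square≡) (SPref-of-suffix-is-square 2p≤m V≺U) ,
  trans square≡ (trans (square-is-prefix 2p≤m) (cong (λ l → take l T′) (sym 2p≡p+p)))
  where
  2p≡p+p : 2 * p ≡ p + p
  2p≡p+p = cong (p +_) (+-identityʳ p)
  2p+p≤n : p + p + p ≤ length T
  2p+p≤n = subst (_≤ length T) (trans (cong (p +_) 2p≡p+p) (+-comm p (p + p))) 3p≤n
  2p≤m : p + p ≤ length T ∸ p
  2p≤m = m+n≤o⇒m≤o∸n (p + p) 2p+p≤n
  open PreGaloisWord T-preGalois p-odd p-per p-least-odd (m+n≤o⇒m≤o (p + p) 2p+p≤n)
  open Appended z
  V≺U : V ≺alt U
  V≺U = subst (_≺alt U) (trans (cong (factor T′ (p + 1)) (sym (length-++ T))) (factor-suffix T′ p)) suffix≺prefix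
  square≡ : factor T′ (p + 1) (3 * p) ≡ take (p + p) V
  square≡ = trans (factor-from T′ p (3 * p)) (cong (λ l → take l V) (trans (m+n∸m≡n p (2 * p)) 2p≡p+p))
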